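{- Let $\mathcal{D}=(D,\lambda)$ be a temporal digraph with lifetime $2$, where $\lambda(e)$ is a non-empty subset of $\{1,2\}$ for every arc $e$. If $\mathcal{D}$ contains no temporal weak-cycle, then $D$ has no cycle on fewer than $6$ vertices; moreover, for every cycle $C=(a,e_1,b,e_2,c,e_3,d,e_4,e,e_5,f,e_6,a)$ of $D$ on $6$ vertices, $|\lambda(e_i)|=1$ for every $i\in[6]$ and $\lambda(e_1)=\lambda(e_3)=\lambda(e_5)\neq\lambda(e_2)=\lambda(e_4)=\lambda(e_6)$.
   Context: $D$ is a finite simple digraph (no loops or parallel arcs; opposite arcs allowed). Non-strict model: a temporal walk is a sequence $(v_1,t_1,v_2,\dots,v_q,t_q,v_{q+1})$ with $q\ge1$, $v_iv_{i+1}\in A(D)$, $t_i\in\lambda(v_iv_{i+1})$, and $t_1\le\dots\le t_q$. A temporal $x,y$-path is such a walk with $v_1=x$, $v_{q+1}=y$ and all vertices distinct, except that when $x=y$ we require $v_1=v_{q+1}$ and $v_1,\dots,v_q$ distinct; its arc set is $\{v_iv_{i+1}:i\in[q]\}$. A cycle of $D$ is a closed directed path $(v_1,\dots,v_q,v_1)$ with $q\ge2$ and $v_1,\dots,v_q$ distinct. A cycle $C$ is a temporal weak-cycle of $\mathcal{D}$ if there exist $x,y\in V(C)$ (possibly equal), a temporal $x,y$-path $P$ and a temporal $y,x$-path $P'$ such that the union of the arc sets of $P$ and $P'$ equals the arc set of $C$. -}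

module Defs where

open import Data.Nat using (ℕ; zero; suc; _≤_)
open import Data.Fin using (Fin; zero; suc; inject₁; fromℕ; _≤_)
open import Data.Bool using (Bool; true; false)
open import Data.Product using (Σ; ∃; _×_; _,_)
open import Data.Sum using (_⊎_)
open import Relation.Binary.PropositionalEquality using (_≡_; _≢_)
open import Relation.Nullary using (¬_)
open import Function.Definitions using (Injective)
open import Function.Bundles using (_⇔_)

-- A temporal digraph with lifetime 2 on vertex set Fin n.
-- arc u v ≡ true  iff  uv ∈ A(D)  (a relation: no parallel arcs; opposite arcs allowed)
-- lab u v t ≡ true iff t ∈ λ(uv); λ(uv) is a non-empty subset of {1,2} for every arc.
record TemporalDigraph2 : Set where
  field
    n        : ℕ
    arc      : Fin n → Fin n → Bool
    loopless : ∀ v → arc v v ≡ false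
    lab      : Fin n → Fin n → ℕ → Bool
    lab-arc  : ∀ u v t → lab u v t ≡ true → arc u v ≡ true
    lab-life : ∀ u v t → lab u v t ≡ true → (t ≡ 1) ⊎ (t ≡ 2)
    lab-ne   : ∀ u v → arc u v ≡ true → ∃ λ t → lab u v t ≡ true

module _ (𝒟 : TemporalDigraph2) where
  open TemporalDigraph2 𝒟

  V : Set
  V = Fin n

  -- A temporal walk (v_1,t_1,...,v_q,t_q,v_{q+1}) with q = suc k ≥ 1,
  -- vertices indexed by Fin (suc q), times by Fin q.
  record TemporalWalk (k : ℕ) : Set where
    field
      vs    : Fin (suc (suc k)) → V
      ts    : Fin (suc k) → ℕ
      arcs  : ∀ i → arc (vs (inject₁ i)) (vs (suc i)) ≡ true
      times : ∀ i → lab (vs (inject₁ i)) (vs (suc i)) (ts i) ≡ true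
      mono  : ∀ i j → i Data.Fin.≤ j → ts i Data.Nat.≤ ts j

  record TemporalPath (x y : V) : Set where
    field
      k      : ℕ
      walk   : TemporalWalk k
    open TemporalWalk walk public
    field
      start  : vs zero ≡ x
      end    : vs (fromℕ (suc k)) ≡ y
      distinct≢ : x ≢ y → Injective _≡_ _≡_ vs
      distinct≡ : x ≡ y → Injective _≡_ _≡_ (λ i → vs (inject₁ i))

  InPath : ∀ {x y} → TemporalPath x y → V → V → Set
  InPath P u v = Σ (Fin (suc (TemporalPath.k P))) λ i →
    (TemporalPath.vs P (inject₁ i) ≡ u) × (TemporalPath.vs P (suc i) ≡ v)

  -- a cycle (c_0,...,c_m,c_0) of D on suc m vertices, m ≥ 1 (i.e. at least 2 vertices)
  record CycleOn (m : ℕ) : Set where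
    field
      c        : Fin (suc m) → V
      long     : 1 Data.Nat.≤ m
      distinct : Injective _≡_ _≡_ c
      arcs     : ∀ (i : Fin m) → arc (c (inject₁ i)) (c (suc i)) ≡ true
      closing  : arc (c (fromℕ m)) (c zero) ≡ true

  InCycle : ∀ {m} → CycleOn m → V → V → Set
  InCycle {m} C u v =
    (Σ (Fin m) λ i → (CycleOn.c C (inject₁ i) ≡ u) × (CycleOn.c C (suc i) ≡ v))
    ⊎ ((CycleOn.c C (fromℕ m) ≡ u) × (CycleOn.c C zero ≡ v))

  OnCycle : ∀ {m} → CycleOn m → V → Set
  OnCycle {m} C x = ∃ λ i → CycleOn.c C i ≡ x

  IsTemporalWeakCycle : ∀ {m} → CycleOn m → Set
  IsTemporalWeakCycle C =
    Σ V λ x → Σ V λ y → OnCycle C x × OnCycle C y ×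
    Σ (TemporalPath x y) λ P → Σ (TemporalPath y x) λ P' →
      ∀ u v → ((InPath P u v ⊎ InPath P' u v) ⇔ InCycle C u v)

  HasTemporalWeakCycle : Set
  HasTemporalWeakCycle = Σ ℕ λ m → Σ (CycleOn m) IsTemporalWeakCycle

  Singleton : V → V → Set
  Singleton u v = ∃ λ t → (lab u v t ≡ true) × (∀ t' → lab u v t' ≡ true → t' ≡ t)

  SameLabel : V → V → V → V → Set
  SameLabel u v u' v' = ∀ t → lab u v t ≡ lab u' v' t

-- Fixing one time of every arc of a cycle turns the cycle into a cyclic word over {1, 2}.
-- A forward stretch of the cycle along which the word is non-decreasing is a temporal path,
-- so if the word splits into two such stretches (from x to y and back from y to x) the cycle
-- is a temporal weak-cycle. Every cyclic word of length at most 5 splits, and the only words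
-- of length 6 that do not are the two alternating ones; these finite facts are decided by
-- exhaustive search. Hence without weak-cycles there is no cycle on fewer than 6 vertices,
-- and on a 6-cycle every choice of times alternates. As changing the choice on a single arc
-- destroys alternation, every arc carries exactly one time, and the times alternate.
module Submission where

open import Defs
open import Data.Nat using (ℕ; suc; _≤_; _<_; s≤s)
open import Data.Nat.Properties using (≮⇒≥; _≤?_)
open import Data.Nat.GeneralisedArithmetic using (fold)
open import Data.Fin using (Fin; zero; suc; inject₁; fromℕ; toℕ; #_) renaming (_≤_ to _≤ᶠ_)
import Data.Fin.Properties as Fin
open import Data.Fin.Relation.Unary.Top using (view; ‵fromℕ; ‵inject₁; view-inject₁; view-fromℕ)
open import Data.Fin.Subset.Properties using (anySubset?)
open import Data.Bool using (Bool; true; false; not)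
open import Data.Bool.Properties using (not-injective; not-¬; not-involutive; ⇔→≡)
import Data.Bool.Properties as Bool
open import Data.Vec using (Vec; lookup; tabulate; _[_]≔_)
open import Data.Vec.Properties using (lookup∘tabulate; lookup∘update; lookup∘update′)
open import Data.Product using (∃; _×_; _,_; proj₁; proj₂)
open import Data.Sum using (_⊎_; inj₁; inj₂)
open import Data.Empty using (⊥-elim)
open import Relation.Nullary using (¬_; Dec; yes; no)
open import Relation.Nullary.Decidable using (toWitness; map′; _×-dec_; _⊎-dec_; _→-dec_; ¬?; decidable-stable)
open import Relation.Unary using (Pred; Decidable)
open import Relation.Binary.PropositionalEquality
open import Function.Base using (_∘_)
open import Function.Bundles using (_⇔_; mk⇔; Equivalence)
open Equivalence using (to; from)

all-Vec? : ∀ {n p} {P : Pred (Vec Bool n) p} → Decidable P → Dec (∀ w → P w)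
all-Vec? P? = map′ (λ ¬∃¬P w → decidable-stable (P? w) (λ ¬Pw → ¬∃¬P (w , ¬Pw)))
                   (λ ∀P (w , ¬Pw) → ¬Pw (∀P w))
                   (¬? (anySubset? λ w → ¬? (P? w)))

next : ∀ {m} → Fin (suc m) → Fin (suc m)
next i with view i
... | ‵fromℕ     = zero
... | ‵inject₁ j = suc j

next-inject₁ : ∀ {m} (i : Fin m) → next (inject₁ i) ≡ suc i
next-inject₁ i rewrite view-inject₁ i = refl

next-fromℕ : ∀ m → next (fromℕ m) ≡ zero
next-fromℕ m rewrite view-fromℕ m = refl

_⊕_ : ∀ {m} → Fin (suc m) → ℕ → Fin (suc m)
s ⊕ k = fold s next k

timeOf : Bool → ℕ
timeOf false = 1
timeOf true  = 2

timeOf-injective : ∀ {a b} → timeOf a ≡ timeOf b → a ≡ b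
timeOf-injective {false} {false} _ = refl
timeOf-injective {true}  {true}  _ = refl

Alternating : ∀ {m} → Vec Bool (suc m) → Set
Alternating w = ∀ i → lookup w (next i) ≡ not (lookup w i)

alternating? : ∀ {m} → Decidable (Alternating {m})
alternating? w = Fin.all? λ i → lookup w (next i) Bool.≟ not (lookup w i)

alternating-step : ∀ {m} (w : Vec Bool (suc m)) → Alternating w → ∀ i → lookup w i ≢ lookup w (next i)
alternating-step w alt i eq = not-¬ (sym eq) (alt i)

alternating-twoStep : ∀ {m} (w : Vec Bool (suc m)) → Alternating w → ∀ i → lookup w i ≡ lookup w (next (next i))
alternating-twoStep w alt i = begin
  lookup w i                    ≡⟨ not-involutive _ ⟨
  not (not (lookup w i))        ≡⟨ cong not (alt i) ⟨
  not (lookup w (next i))       ≡⟨ alt (next i) ⟨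
  lookup w (next (next i))      ∎
  where open ≡-Reasoning

alternating-update : ∀ {m} (w : Vec Bool (suc m)) {i b} →
  Alternating w → Alternating (w [ i ]≔ b) → b ≡ lookup w i
alternating-update w {i} {b} alt alt′ = not-injective (begin
  not b                         ≡⟨ cong not (lookup∘update i w b) ⟨
  not (lookup (w [ i ]≔ b) i)   ≡⟨ alt′ i ⟨
  lookup (w [ i ]≔ b) (next i)  ≡⟨ lookup∘update′ next≢i w b ⟩
  lookup w (next i)             ≡⟨ alt i ⟩
  not (lookup w i)              ∎)
  where
    open ≡-Reasoning
    next≢i : next i ≢ i
    next≢i eq = alternating-step w alt i (cong (lookup w) (sym eq))

module _ {m} (w : Vec Bool (suc m)) where

  time : Fin (suc m) → ℕ
  time j = timeOf (lookup w j)

  Simple : Fin (suc m) → ℕ → Set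
  Simple s k = ∀ (i j : Fin (suc (suc k))) → s ⊕ toℕ i ≡ s ⊕ toℕ j → i ≡ j

  Monotone : Fin (suc m) → ℕ → Set
  Monotone s k = ∀ (i j : Fin (suc k)) → i ≤ᶠ j → time (s ⊕ toℕ i) ≤ time (s ⊕ toℕ j)

  Segment : Fin (suc m) → ℕ → Fin (suc m) → Set
  Segment s k s′ = (s ⊕ suc k ≡ s′) × Simple s k × Monotone s k

  segment? : ∀ s k s′ → Dec (Segment s k s′)
  segment? s k s′ = (s ⊕ suc k Fin.≟ s′)
    ×-dec (Fin.all? λ i → Fin.all? λ j → (s ⊕ toℕ i Fin.≟ s ⊕ toℕ j) →-dec (i Fin.≟ j))
    ×-dec (Fin.all? λ i → Fin.all? λ j → (i Fin.≤? j) →-dec (time (s ⊕ toℕ i) ≤? time (s ⊕ toℕ j)))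

  OnSegment : Fin (suc m) → ℕ → Fin (suc m) → Set
  OnSegment s k j = ∃ λ (i : Fin (suc k)) → s ⊕ toℕ i ≡ j

  Split : Set
  Split = ∃ λ s → ∃ λ s′ → ∃ λ (k : Fin (suc m)) → ∃ λ (k′ : Fin (suc m)) →
    Segment s (toℕ k) s′ × Segment s′ (toℕ k′) s × (∀ j → OnSegment s (toℕ k) j ⊎ OnSegment s′ (toℕ k′) j)

  split? : Dec Split
  split? = Fin.any? λ s → Fin.any? λ s′ → Fin.any? λ k → Fin.any? λ k′ →
    segment? s (toℕ k) s′ ×-dec segment? s′ (toℕ k′) s
    ×-dec Fin.all? λ j → onSegment? s (toℕ k) j ⊎-dec onSegment? s′ (toℕ k′) j
    where
      onSegment? : ∀ s k j → Dec (OnSegment s k j)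
      onSegment? s k j = Fin.any? λ i → s ⊕ toℕ i Fin.≟ j

-- Abstract, so that the exhaustive searches are not re-run where these facts are used.
abstract
  short-split : ∀ {m} → 1 ≤ m → m < 5 → (w : Vec Bool (suc m)) → Split w
  short-split {1} _ _ = toWitness {a? = all-Vec? split?} _
  short-split {2} _ _ = toWitness {a? = all-Vec? split?} _
  short-split {3} _ _ = toWitness {a? = all-Vec? split?} _
  short-split {4} _ _ = toWitness {a? = all-Vec? split?} _
  short-split {suc (suc (suc (suc (suc _))))} _ (s≤s (s≤s (s≤s (s≤s (s≤s ())))))

  hexagon-alternating-or-split : (w : Vec Bool 6) → Alternating w ⊎ Split w
  hexagon-alternating-or-split = toWitness {a? = all-Vec? λ w → alternating? w ⊎-dec split? w} _

module _ (𝒟 : TemporalDigraph2) where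
  open TemporalDigraph2 𝒟

  lab-timeOf : ∀ {u v t} → lab u v t ≡ true → ∃ λ b → timeOf b ≡ t
  lab-timeOf {u} {v} {t} p with lab-life u v t p
  ... | inj₁ refl = false , refl
  ... | inj₂ refl = true , refl

  module _ {m} (C : CycleOn 𝒟 m) where
    open CycleOn C

    cycle-arc : ∀ j → arc (c j) (c (next j)) ≡ true
    cycle-arc j with view j
    ... | ‵fromℕ     = closing
    ... | ‵inject₁ i = arcs i

    step⇒InCycle : ∀ j → InCycle 𝒟 C (c j) (c (next j))
    step⇒InCycle j with view j
    ... | ‵fromℕ     = inj₂ (refl , refl)
    ... | ‵inject₁ i = inj₁ (i , refl , refl)

    InCycle⇒step : ∀ {u v} → InCycle 𝒟 C u v → ∃ λ j → c j ≡ u × c (next j) ≡ v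
    InCycle⇒step (inj₁ (i , p , q)) = inject₁ i , p , trans (cong c (next-inject₁ i)) q
    InCycle⇒step (inj₂ (p , q))     = fromℕ m , p , trans (cong c (next-fromℕ m)) q

    ValidChoice : Vec Bool (suc m) → Set
    ValidChoice w = ∀ j → lab (c j) (c (next j)) (time w j) ≡ true

    validChoice-exists : ∃ ValidChoice
    validChoice-exists = tabulate (proj₁ ∘ choose) , valid
      where
        choose : ∀ j → ∃ λ b → lab (c j) (c (next j)) (timeOf b) ≡ true
        choose j with lab-ne _ _ (cycle-arc j)
        ... | t , p with lab-timeOf p
        ... | b , refl = b , p
        valid : ValidChoice (tabulate (proj₁ ∘ choose))
        valid j rewrite lookup∘tabulate (proj₁ ∘ choose) j = proj₂ (choose j)

    validChoice-update : ∀ w {i} {b} → ValidChoice w → lab (c i) (c (next i)) (timeOf b) ≡ true →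
                         ValidChoice (w [ i ]≔ b)
    validChoice-update w {i} {b} valid p j with j Fin.≟ i
    ... | yes refl rewrite lookup∘update i w b = p
    ... | no j≢i   rewrite lookup∘update′ j≢i w b = valid j

    module _ (w : Vec Bool (suc m)) (valid : ValidChoice w) where

      segment-path : ∀ {s k s′} → Segment w s k s′ → TemporalPath 𝒟 (c s) (c s′)
      segment-path {s} {k} {s′} (end , simple , monotone) = record
        { k = k
        ; walk = record
          { vs    = λ i → c (s ⊕ toℕ i)
          ; ts    = λ i → time w (s ⊕ toℕ i)
          ; arcs  = arc-at
          ; times = lab-at
          ; mono  = monotone
          }
        ; start = refl
        ; end = cong c (trans (cong (s ⊕_) (Fin.toℕ-fromℕ (suc k))) end)
        ; distinct≢ = λ _ → injective
        ; distinct≡ = λ _ eq → Fin.inject₁-injective (injective eq)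
        }
        where
          arc-at : ∀ (i : Fin (suc k)) → arc (c (s ⊕ toℕ (inject₁ i))) (c (next (s ⊕ toℕ i))) ≡ true
          arc-at i rewrite Fin.toℕ-inject₁ i = cycle-arc _
          lab-at : ∀ (i : Fin (suc k)) →
                   lab (c (s ⊕ toℕ (inject₁ i))) (c (next (s ⊕ toℕ i))) (time w (s ⊕ toℕ i)) ≡ true
          lab-at i rewrite Fin.toℕ-inject₁ i = valid _
          injective : ∀ {i j} → c (s ⊕ toℕ i) ≡ c (s ⊕ toℕ j) → i ≡ j
          injective {i} {j} eq = simple i j (distinct eq)

      segment-path-arcs : ∀ {s k s′ u v} (seg : Segment w s k s′) →
        InPath 𝒟 (segment-path seg) u v ⇔ ∃ λ (i : Fin (suc k)) → c (s ⊕ toℕ i) ≡ u × c (next (s ⊕ toℕ i)) ≡ v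
      segment-path-arcs {s} _ = mk⇔
        (λ (i , p , q) → i , trans (cong (c ∘ (s ⊕_)) (sym (Fin.toℕ-inject₁ i))) p , q)
        (λ (i , p , q) → i , trans (cong (c ∘ (s ⊕_)) (Fin.toℕ-inject₁ i)) p , q)

      split⇒weakCycle : Split w → IsTemporalWeakCycle 𝒟 C
      split⇒weakCycle (s , s′ , k , k′ , seg , seg′ , cover) =
        c s , c s′ , (s , refl) , (s′ , refl) , segment-path seg , segment-path seg′ ,
        λ u v → mk⇔ (P∪P′⊆C u v) (C⊆P∪P′ u v)
        where
          P∪P′⊆C : ∀ u v → InPath 𝒟 (segment-path seg) u v ⊎ InPath 𝒟 (segment-path seg′) u v → InCycle 𝒟 C u v
          P∪P′⊆C u v (inj₁ uv∈P) with segment-path-arcs seg .to uv∈P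
          ... | _ , refl , refl = step⇒InCycle _
          P∪P′⊆C u v (inj₂ uv∈P′) with segment-path-arcs seg′ .to uv∈P′
          ... | _ , refl , refl = step⇒InCycle _
          C⊆P∪P′ : ∀ u v → InCycle 𝒟 C u v → InPath 𝒟 (segment-path seg) u v ⊎ InPath 𝒟 (segment-path seg′) u v
          C⊆P∪P′ u v uv∈C with InCycle⇒step uv∈C
          ... | j , refl , refl with cover j
          ... | inj₁ (i , refl) = inj₁ (segment-path-arcs seg .from (i , refl , refl))
          ... | inj₂ (i , refl) = inj₂ (segment-path-arcs seg′ .from (i , refl , refl))

    allSplit⇒weakCycle : (∀ w → Split w) → IsTemporalWeakCycle 𝒟 C
    allSplit⇒weakCycle split = let (w , valid) = validChoice-exists in split⇒weakCycle w valid (split w)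

  module Hexagon (noWeak : ¬ HasTemporalWeakCycle 𝒟) (C : CycleOn 𝒟 5) where
    open CycleOn C

    validChoice⇒alternating : ∀ w → ValidChoice C w → Alternating w
    validChoice⇒alternating w valid with hexagon-alternating-or-split w
    ... | inj₁ alt   = alt
    ... | inj₂ split = ⊥-elim (noWeak (5 , C , split⇒weakCycle C w valid split))

    w : Vec Bool 6
    w = proj₁ (validChoice-exists C)

    valid : ValidChoice C w
    valid = proj₂ (validChoice-exists C)

    alternating : Alternating w
    alternating = validChoice⇒alternating w valid

    lab⇔choice : ∀ j {t} → lab (c j) (c (next j)) t ≡ true ⇔ t ≡ time w j
    lab⇔choice j = mk⇔ unique (λ { refl → valid j })
      where
        unique : ∀ {t} → lab (c j) (c (next j)) t ≡ true → t ≡ time w j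
        unique p with lab-timeOf p
        ... | b , refl = cong timeOf (alternating-update w {j} {b} alternating
          (validChoice⇒alternating (w [ j ]≔ b) (validChoice-update C w {j} {b} valid p)))

    singleton : ∀ j → Singleton 𝒟 (c j) (c (next j))
    singleton j = time w j , valid j , λ _ → lab⇔choice j .to

    sameLabel : ∀ {i j} → lookup w i ≡ lookup w j → SameLabel 𝒟 (c i) (c (next i)) (c j) (c (next j))
    sameLabel {i} {j} eq t = ⇔→≡ (mk⇔
      (λ p → lab⇔choice j .from (trans (lab⇔choice i .to p) (cong timeOf eq)))
      (λ p → lab⇔choice i .from (trans (lab⇔choice j .to p) (cong timeOf (sym eq)))))

    distinctLabel : ∀ {i j} → lookup w i ≢ lookup w j → ¬ SameLabel 𝒟 (c i) (c (next i)) (c j) (c (next j))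
    distinctLabel {i} {j} neq same = neq (timeOf-injective (lab⇔choice j .to (trans (sym (same _)) (valid i))))

    alternate-sameLabel : ∀ i → SameLabel 𝒟 (c i) (c (next i)) (c (next (next i))) (c (next (next (next i))))
    alternate-sameLabel i = sameLabel (alternating-twoStep w alternating i)

    adjacent-distinctLabel : ∀ i → ¬ SameLabel 𝒟 (c i) (c (next i)) (c (next i)) (c (next (next i)))
    adjacent-distinctLabel i = distinctLabel (alternating-step w alternating i)

proposition6 : (𝒟 : TemporalDigraph2) → ¬ HasTemporalWeakCycle 𝒟 →
  ((m : ℕ) → CycleOn 𝒟 m → 6 ≤ ℕ.suc m)
  × ((C : CycleOn 𝒟 5) →
      let a = CycleOn.c C zero
          b = CycleOn.c C (suc zero)
          c = CycleOn.c C (suc (suc zero))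
          d = CycleOn.c C (suc (suc (suc zero)))
          e = CycleOn.c C (suc (suc (suc (suc zero))))
          f = CycleOn.c C (suc (suc (suc (suc (suc zero)))))
      in (Singleton 𝒟 a b × Singleton 𝒟 b c × Singleton 𝒟 c d
          × Singleton 𝒟 d e × Singleton 𝒟 e f × Singleton 𝒟 f a)
         × SameLabel 𝒟 a b c d × SameLabel 𝒟 c d e f
         × SameLabel 𝒟 b c d e × SameLabel 𝒟 d e f a
         × ¬ SameLabel 𝒟 a b b c)
proposition6 𝒟 noWeak = noShortCycle , λ C → let open Hexagon 𝒟 noWeak C in
    (singleton (# 0) , singleton (# 1) , singleton (# 2) , singleton (# 3) , singleton (# 4) , singleton (# 5))
    , alternate-sameLabel (# 0) , alternate-sameLabel (# 2)
    , alternate-sameLabel (# 1) , alternate-sameLabel (# 3)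
    , adjacent-distinctLabel (# 0)
  where
    noShortCycle : (m : ℕ) → CycleOn 𝒟 m → 6 ≤ suc m
    noShortCycle m C = s≤s (≮⇒≥ λ m<5 →
      noWeak (m , C , allSplit⇒weakCycle 𝒟 C (short-split (CycleOn.long C) m<5)))
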